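{- Let $\mathfrak{n}$ be an odd (i.e. coprime to $2$), integral, non-zero ideal of $\mathbb{Z}[\zeta_8]$. For a generator $w = a + b\zeta_8 + c\zeta_8^2 + d\zeta_8^3$ ($a,b,c,d \in \mathbb{Z}$) of $\mathfrak{n}$, set $u := a^2+b^2+c^2+d^2$, $v := ab - ad + bc + cd$ and $g := u + v$. Then the Jacobi symbol $\left(\frac{ -1}{g}\right)$ takes the same value for all generators $w$ of $\mathfrak{n}$.
   Context: $\zeta_8$ is a primitive $8$th root of unity. For odd $w$ one has that $u$ is odd, $v$ is even, and $g = \frac12(a+b)^2+\frac12(a-d)^2+\frac12(b+c)^2+\frac12(c+d)^2$ is a positive odd integer, so the Jacobi symbol is defined. (Equivalently, $w\tau(w) = u + v\sqrt{2}$ where $\tau$ is the automorphism of $\mathbb{Q}(\zeta_8)$ fixing $\mathbb{Q}(\sqrt 2)$, i.e. $\tau(\zeta_8)=\zeta_8^{ -1}$.) -}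

module Defs where

open import Data.Nat as Nat using (ℕ; zero; suc)
open import Data.Integer as ℤ using (ℤ; +_; -_; _%ℕ_)
open import Data.Bool using (Bool; true; false; if_then_else_)
open import Data.Product using (Σ; _×_; _,_; ∃; ∃-syntax)
open import Relation.Binary.PropositionalEquality using (_≡_)
open import Relation.Nullary using (¬_)
open import Relation.Nullary.Decidable using (does)

-- The ring ℤ[ζ₈] ≅ ℤ[x]/(x⁴+1): an element a + bζ + cζ² + dζ³
-- is stored as its coordinate quadruple (a , b , c , d).

record Zζ8 : Set where
  constructor mk
  field
    a b c d : ℤ

open Zζ8 public

zero8 : Zζ8
zero8 = mk (+ 0) (+ 0) (+ 0) (+ 0)

one8 : Zζ8
one8 = mk (+ 1) (+ 0) (+ 0) (+ 0)

two8 : Zζ8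
two8 = mk (+ 2) (+ 0) (+ 0) (+ 0)

infixl 6 _+₈_
infixl 7 _*₈_

_+₈_ : Zζ8 → Zζ8 → Zζ8
mk a b c d +₈ mk a' b' c' d' = mk (a ℤ.+ a') (b ℤ.+ b') (c ℤ.+ c') (d ℤ.+ d')

-- multiplication using ζ⁴ = -1
_*₈_ : Zζ8 → Zζ8 → Zζ8
mk a b c d *₈ mk e f g h =
  mk (a ℤ.* e ℤ.- b ℤ.* h ℤ.- c ℤ.* g ℤ.- d ℤ.* f)
     (a ℤ.* f ℤ.+ b ℤ.* e ℤ.- c ℤ.* h ℤ.- d ℤ.* g)
     (a ℤ.* g ℤ.+ b ℤ.* f ℤ.+ c ℤ.* e ℤ.- d ℤ.* h)
     (a ℤ.* h ℤ.+ b ℤ.* g ℤ.+ c ℤ.* f ℤ.+ d ℤ.* e)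

SameIdeal : Zζ8 → Zζ8 → Set
SameIdeal w w' = (∃[ x ] w' ≡ x *₈ w) × (∃[ y ] w ≡ y *₈ w')

OddIdeal : Zζ8 → Set
OddIdeal w = ∃[ x ] ∃[ y ] x *₈ w +₈ y *₈ two8 ≡ one8

uOf : Zζ8 → ℤ
uOf (mk a b c d) = a ℤ.* a ℤ.+ b ℤ.* b ℤ.+ c ℤ.* c ℤ.+ d ℤ.* d

vOf : Zζ8 → ℤ
vOf (mk a b c d) = a ℤ.* b ℤ.- a ℤ.* d ℤ.+ b ℤ.* c ℤ.+ c ℤ.* d

gOf : Zζ8 → ℤ
gOf w = uOf w ℤ.+ vOf w

isSquareMod : (a : ℤ) (p : ℕ) .{{_ : Nat.NonZero p}} → ℕ → Bool
isSquareMod a p zero    = false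
isSquareMod a p (suc k) =
  if does (((+ k) ℤ.* (+ k) ℤ.- a) %ℕ p Nat.≟ 0) then true else isSquareMod a p k

legendre : (a : ℤ) (p : ℕ) .{{_ : Nat.NonZero p}} → ℤ
legendre a p =
  if does (a %ℕ p Nat.≟ 0) then + 0
  else (if isSquareMod a p p then + 1 else - (+ 1))

leastDivFrom : ℕ → ℕ → ℕ → ℕ
leastDivFrom n d zero    = n
leastDivFrom n d (suc k) =
  if does (n % suc (suc d) Nat.≟ 0) then suc (suc d) else leastDivFrom n (suc d) k
  where open Nat using (_%_)

leastPrimeFactor : ℕ → ℕ
leastPrimeFactor n = leastDivFrom n 0 n

-- The fuel argument (initialised to n) bounds the number of prime factors.
jacobiAux : ℕ → ℤ → ℕ → ℤ
jacobiAux zero    a n = + 1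
jacobiAux (suc k) a zero = + 1
jacobiAux (suc k) a (suc zero) = + 1
jacobiAux (suc k) a n@(suc (suc m)) with leastPrimeFactor n
... | zero  = + 1
... | p@(suc q) = legendre a p ℤ.* jacobiAux k a (n Nat./ p)

jacobi : ℤ → ℕ → ℤ
jacobi a n = jacobiAux n a n

module Submission where

-- A generator w′ of (w) is x w for a unit x.  Since u + v√2 = w τ(w) is multiplicative,
-- u(xw) + v(xw)√2 = (U + V√2)(u + v√2) with U + V√2 = x τ(x) a unit of ℤ[√2] of norm
-- U² − 2V² = N(x) = 1 and U ≥ 0.  Descending along 3 − 2√2 shows U + V√2 ≡ 1 or 3 + 2√2
-- (mod 4); as u is odd and v even for odd w, g = u + v changes by a multiple of 4.
-- Finally (−1/g) only depends on g mod 4: it is multiplicative in g, and (−1/p) = χ₄(p) for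
-- an odd prime p = 2h + 1 because pairing s ∈ {1, …, h} with the representative of ±s⁻¹ is
-- an involution whose fixed points are 1 and, if −1 is a square, the representative of √−1.

open import Defs
open import Relation.Binary.Definitions using (DecidableEquality)

module Involutions {a} {A : Set a} (_≟_ : DecidableEquality A) where
  open import Data.Nat using (suc; _+_; _*_; _≤_; s≤s)
  open import Data.Nat.Properties using (≤-refl; ≤-trans; n≤1+n; ≤-reflexive)
  open import Data.Nat.Tactic.RingSolver using (solve-∀)
  open import Data.List using (List; []; _∷_; length; filter)
  open import Data.List.Properties using (filter-all)
  open import Data.List.Membership.Propositional using (_∈_)
  open import Data.List.Membership.Propositional.Properties using (∈-filter⁺; ∈-filter⁻)
  open import Data.List.Relation.Unary.Any using (here; there)
  open import Data.List.Relation.Unary.AllPairs as AllPairs using ()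
  open import Data.List.Relation.Unary.Unique.Propositional using (Unique; []; _∷_)
  open import Data.List.Relation.Unary.Unique.Propositional.Properties using (filter⁺; Unique[x∷xs]⇒x∉xs)
  open import Data.Product using (_×_; _,_; proj₁; ∃-syntax)
  open import Data.Empty using (⊥-elim)
  open import Function using (_∘_)
  open import Relation.Binary.PropositionalEquality
  open import Relation.Nullary using (¬_; yes; no; ¬?)

  remove : A → List A → List A
  remove y = filter (¬? ∘ (y ≟_))

  ∈-remove⁺ : ∀ {x y xs} → x ∈ xs → y ≢ x → x ∈ remove y xs
  ∈-remove⁺ = ∈-filter⁺ (¬? ∘ (_ ≟_))

  ∈-remove⁻ : ∀ {x y xs} → x ∈ remove y xs → x ∈ xs × y ≢ x
  ∈-remove⁻ = ∈-filter⁻ (¬? ∘ (_ ≟_))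

  remove⁺ : ∀ {y xs} → Unique xs → Unique (remove y xs)
  remove⁺ = filter⁺ (¬? ∘ (_ ≟_))

  length-remove : ∀ {y xs} → Unique xs → y ∈ xs → suc (length (remove y xs)) ≡ length xs
  length-remove {y} {x ∷ xs} (y≢xs ∷ _) (here refl) with y ≟ y
  ... | yes _ = cong (suc ∘ length) (filter-all (¬? ∘ (y ≟_)) y≢xs)
  ... | no y≢y = ⊥-elim (y≢y refl)
  length-remove {y} {x ∷ xs} x∷xs-unique@(_ ∷ xs-unique) (there y∈xs) with y ≟ x
  ... | yes refl = ⊥-elim (Unique[x∷xs]⇒x∉xs x∷xs-unique y∈xs)
  ... | no _ = cong suc (length-remove xs-unique y∈xs)

  record IsInvolutionOn (f : A → A) (xs : List A) : Set a where
    field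
      unique     : Unique xs
      closed     : ∀ {x} → x ∈ xs → f x ∈ xs
      involutive : ∀ {x} → x ∈ xs → f (f x) ≡ x

  record FixedPointsOf (f : A → A) (xs fs : List A) : Set a where
    field
      unique   : Unique fs
      sound    : ∀ {x} → x ∈ fs → x ∈ xs × f x ≡ x
      complete : ∀ {x} → x ∈ xs → f x ≡ x → x ∈ fs

  module _ {f : A → A} {x : A} {xs fs : List A}
           (inv : IsInvolutionOn f (x ∷ xs)) (fix : FixedPointsOf f (x ∷ xs) fs) where
    open IsInvolutionOn inv
    open FixedPointsOf fix renaming (unique to fs-unique)

    private
      x∉xs : ∀ {y} → y ∈ xs → x ≢ y
      x∉xs y∈xs refl = Unique[x∷xs]⇒x∉xs unique y∈xs

    drop-fixed : f x ≡ x → IsInvolutionOn f xs × FixedPointsOf f xs (remove x fs)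
    drop-fixed fx≡x = record { unique = AllPairs.tail unique ; closed = closed′ ; involutive = involutive ∘ there }
                    , record { unique = remove⁺ fs-unique ; sound = sound′ ; complete = complete′ }
      where
      closed′ : ∀ {y} → y ∈ xs → f y ∈ xs
      closed′ y∈xs with closed (there y∈xs)
      ... | there fy∈xs = fy∈xs
      ... | here fy≡x = ⊥-elim (x∉xs y∈xs (trans (sym fx≡x) (trans (cong f (sym fy≡x)) (involutive (there y∈xs)))))
      sound′ : ∀ {y} → y ∈ remove x fs → y ∈ xs × f y ≡ y
      sound′ y∈ with ∈-remove⁻ y∈
      ... | y∈fs , x≢y with sound y∈fs
      ...   | here refl , _ = ⊥-elim (x≢y refl)
      ...   | there y∈xs , fy≡y = y∈xs , fy≡y
      complete′ : ∀ {y} → y ∈ xs → f y ≡ y → y ∈ remove x fs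
      complete′ y∈xs fy≡y = ∈-remove⁺ (complete (there y∈xs) fy≡y) (x∉xs y∈xs)

    drop-pair : f x ≢ x → IsInvolutionOn f (remove (f x) xs) × FixedPointsOf f (remove (f x) xs) fs
    drop-pair fx≢x = record { unique = remove⁺ (AllPairs.tail unique) ; closed = closed′ ; involutive = involutive ∘ there ∘ proj₁ ∘ ∈-remove⁻ }
                   , record { unique = fs-unique ; sound = sound′ ; complete = complete′ }
      where
      closed′ : ∀ {y} → y ∈ remove (f x) xs → f y ∈ remove (f x) xs
      closed′ y∈ with ∈-remove⁻ y∈
      ... | y∈xs , fx≢y with closed (there y∈xs)
      ...   | here fy≡x = ⊥-elim (fx≢y (trans (cong f (sym fy≡x)) (involutive (there y∈xs))))
      ...   | there fy∈xs = ∈-remove⁺ fy∈xs λ fx≡fy →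
                x∉xs y∈xs (trans (sym (involutive (here refl))) (trans (cong f fx≡fy) (involutive (there y∈xs))))
      sound′ : ∀ {y} → y ∈ fs → y ∈ remove (f x) xs × f y ≡ y
      sound′ y∈fs with sound y∈fs
      ... | here refl , fx≡x = ⊥-elim (fx≢x fx≡x)
      ... | there y∈xs , fy≡y = ∈-remove⁺ y∈xs (λ fx≡y → x∉xs y∈xs (trans (sym (involutive (here refl))) (trans (cong f fx≡y) fy≡y))) , fy≡y
      complete′ : ∀ {y} → y ∈ remove (f x) xs → f y ≡ y → y ∈ fs
      complete′ y∈ = complete (there (proj₁ (∈-remove⁻ y∈)))

  involution-parity : ∀ {f xs fs} → IsInvolutionOn f xs → FixedPointsOf f xs fs → ∃[ k ] length xs ≡ length fs + 2 * k
  involution-parity {xs = xs} = parity (length xs) ≤-refl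
    where
    parity : ∀ {f} n {xs fs} → length xs ≤ n → IsInvolutionOn f xs → FixedPointsOf f xs fs →
             ∃[ k ] length xs ≡ length fs + 2 * k
    parity n {[]} {[]} _ _ _ = 0 , refl
    parity n {[]} {_ ∷ _} _ _ fix with FixedPointsOf.sound fix (here refl)
    ... | () , _
    parity {f} (suc n) {x ∷ xs} {fs} (s≤s ∣xs∣≤n) inv fix with f x ≟ x
    ... | yes fx≡x =
      let inv′ , fix′ = drop-fixed inv fix fx≡x
          k , ∣xs∣≡ = parity n ∣xs∣≤n inv′ fix′
      in k , (begin
        suc (length xs)                        ≡⟨ cong suc ∣xs∣≡ ⟩
        suc (length (remove x fs)) + 2 * k     ≡⟨ cong (_+ 2 * k) (length-remove (FixedPointsOf.unique fix) x∈fs) ⟩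
        length fs + 2 * k                      ∎)
      where
      open ≡-Reasoning
      x∈fs = FixedPointsOf.complete fix (here refl) fx≡x
    ... | no fx≢x =
      let inv′ , fix′ = drop-pair inv fix fx≢x
          k , ∣xs′∣≡ = parity n (≤-trans (n≤1+n _) (≤-trans (≤-reflexive ∣xs∣≡) ∣xs∣≤n)) inv′ fix′
      in suc k , (begin
        suc (length xs)                          ≡⟨ cong suc (sym ∣xs∣≡) ⟩
        suc (suc (length (remove (f x) xs)))     ≡⟨ cong (suc ∘ suc) ∣xs′∣≡ ⟩
        suc (suc (length fs + 2 * k))            ≡⟨ two-more (length fs) k ⟩
        length fs + 2 * suc k                    ∎)
      where
      open ≡-Reasoning
      two-more : ∀ m k → suc (suc (m + 2 * k)) ≡ m + 2 * suc k
      two-more = solve-∀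
      ∣xs∣≡ : suc (length (remove (f x) xs)) ≡ length xs
      ∣xs∣≡ with IsInvolutionOn.closed inv (here refl)
      ... | here fx≡x = ⊥-elim (fx≢x fx≡x)
      ... | there fx∈xs = length-remove (AllPairs.tail (IsInvolutionOn.unique inv)) fx∈xs

module JacobiSymbol where

  open import Data.Nat as ℕ using (ℕ; zero; suc; _+_; _*_; _≤_; _<_; s≤s; s≤s⁻¹; _%_; _/_; NonTrivial; nonTrivial⇒n>1)
  open import Data.Nat.Properties using (≤-trans; ≤-refl; ≤-reflexive; +-suc; +-identityʳ; m≤n+m; <-≤-trans; 0≢1+n; *-comm)
  open import Data.Nat.DivMod using (m%n<n; m%n%n≡m%n; %-distribˡ-*; m∣n⇒o%n%m≡o%m; m*[n/m]≡n; m/n<m)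
  open import Data.Nat.Divisibility using (_∣_; divides; ∣-refl; m%n≡0⇒n∣m; n∣m⇒m%n≡0; hasNonTrivialDivisor-≤)
  open import Data.Nat.Primality using (Prime; ¬prime[0]; prime⇒nonTrivial; _Rough_; 2-rough; ∤⇒rough-suc; rough∧∣⇒prime)
  open import Data.Integer as ℤ using (ℤ; +_; -_)
  open import Data.Bool using (if_then_else_)
  open import Data.Product using (_×_; _,_)
  open import Data.Sum using (_⊎_; inj₁; inj₂)
  open import Data.Empty using (⊥-elim)
  open import Relation.Binary.PropositionalEquality
  open import Relation.Nullary using (does)

  leastDivFrom-prime : ∀ n d k .{{_ : NonTrivial n}} → n ≤ suc (suc d) + k → suc (suc d) Rough n →
                       Prime (leastDivFrom n d k) × leastDivFrom n d k ∣ n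
  leastDivFrom-prime n d zero n≤2+d rough = rough∧∣⇒prime n-rough ∣-refl , ∣-refl
    where
    n-rough : n Rough n
    n-rough n-composite = rough (hasNonTrivialDivisor-≤ n-composite (≤-trans n≤2+d (≤-reflexive (+-identityʳ _))))
  leastDivFrom-prime n d (suc k) n≤2+d+k rough with n % suc (suc d) in r≡
  ... | zero  = rough∧∣⇒prime rough (m%n≡0⇒n∣m n _ r≡) , m%n≡0⇒n∣m n _ r≡
  ... | suc _ = leastDivFrom-prime n (suc d) k (≤-trans n≤2+d+k (≤-reflexive (+-suc _ k)))
                  (∤⇒rough-suc (λ 2+d∣n → 0≢1+n (trans (sym (n∣m⇒m%n≡0 n _ 2+d∣n)) r≡)) rough)

  leastPrimeFactor-prime : ∀ n .{{_ : NonTrivial n}} → Prime (leastPrimeFactor n) × leastPrimeFactor n ∣ n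
  leastPrimeFactor-prime n = leastDivFrom-prime n 0 n (m≤n+m n 2) 2-rough

  odd-*ˡ : ∀ m n → (m * n) % 2 ≡ 1 → m % 2 ≡ 1
  odd-*ˡ m n mn-odd with m % 2 | m%n<n m 2 | %-distribˡ-* m n 2
  ... | 0           | _                | mn%2≡0 = ⊥-elim (0≢1+n (trans (sym mn%2≡0) mn-odd))
  ... | 1           | _                | _      = refl
  ... | suc (suc _) | s≤s (s≤s ())     | _

  odd-*ʳ : ∀ m n → (m * n) % 2 ≡ 1 → n % 2 ≡ 1
  odd-*ʳ m n mn-odd = odd-*ˡ n m (trans (cong (_% 2) (*-comm n m)) mn-odd)

  module _ (a : ℤ) (χ : ℕ → ℤ) (χ-1 : χ 1 ≡ + 1)
           (χ-* : ∀ {m n} → m % 2 ≡ 1 → n % 2 ≡ 1 → χ (m * n) ≡ χ m ℤ.* χ n)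
           (legendre≡χ : ∀ {q} → Prime (suc q) → suc q % 2 ≡ 1 → legendre a (suc q) ≡ χ (suc q)) where

    jacobiAux≡χ : ∀ k n → n ≤ k → n % 2 ≡ 1 → jacobiAux k a n ≡ χ n
    jacobiAux≡χ zero    zero          _      ()
    jacobiAux≡χ (suc k) zero          _      ()
    jacobiAux≡χ (suc k) (suc zero)    _      _ = sym χ-1
    jacobiAux≡χ (suc k) n@(suc (suc _)) n≤1+k n-odd with leastPrimeFactor n | leastPrimeFactor-prime n
    ... | zero  | 0-prime , _ = ⊥-elim (¬prime[0] 0-prime)
    ... | suc q | p-prime , p∣n = begin
      legendre a p ℤ.* jacobiAux k a (n / p)  ≡⟨ cong₂ ℤ._*_ (legendre≡χ p-prime p-odd) (jacobiAux≡χ k (n / p) n/p≤k n/p-odd) ⟩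
      χ p ℤ.* χ (n / p)                      ≡⟨ sym (χ-* p-odd n/p-odd) ⟩
      χ (p * (n / p))                        ≡⟨ cong χ (m*[n/m]≡n p∣n) ⟩
      χ n                                    ∎
      where
      open ≡-Reasoning
      p = suc q
      p[n/p]-odd : (p * (n / p)) % 2 ≡ 1
      p[n/p]-odd = trans (cong (_% 2) (m*[n/m]≡n p∣n)) n-odd
      p-odd = odd-*ˡ p (n / p) p[n/p]-odd
      n/p-odd = odd-*ʳ p (n / p) p[n/p]-odd
      n/p≤k : n / p ≤ k
      n/p≤k = s≤s⁻¹ (<-≤-trans (m/n<m n p (nonTrivial⇒n>1 p {{prime⇒nonTrivial p-prime}})) n≤1+k)

    jacobi≡χ : ∀ n → n % 2 ≡ 1 → jacobi a n ≡ χ n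
    jacobi≡χ n = jacobiAux≡χ n n ≤-refl

  χ₄ : ℕ → ℤ
  χ₄ n = if does (n % 4 ℕ.≟ 1) then + 1 else - (+ 1)

  χ₄-cong : ∀ m n → m % 4 ≡ n % 4 → χ₄ m ≡ χ₄ n
  χ₄-cong _ _ = cong (λ r → if does (r ℕ.≟ 1) then + 1 else - (+ 1))

  odd⇒%4 : ∀ n → n % 2 ≡ 1 → n % 4 ≡ 1 ⊎ n % 4 ≡ 3
  odd⇒%4 n n-odd with n % 4 | m%n<n n 4 | m∣n⇒o%n%m≡o%m 2 4 n (divides 2 refl)
  ... | 1 | _ | _ = inj₁ refl
  ... | 3 | _ | _ = inj₂ refl
  ... | 0 | _ | n%2≡0 = ⊥-elim (0≢1+n (trans n%2≡0 n-odd))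
  ... | 2 | _ | n%2≡0 = ⊥-elim (0≢1+n (trans n%2≡0 n-odd))
  ... | suc (suc (suc (suc _))) | s≤s (s≤s (s≤s (s≤s ()))) | _

  χ₄-* : ∀ {m n} → m % 2 ≡ 1 → n % 2 ≡ 1 → χ₄ (m * n) ≡ χ₄ m ℤ.* χ₄ n
  χ₄-* {m} {n} m-odd n-odd = begin
    χ₄ (m * n)                  ≡⟨ χ₄-cong (m * n) (m % 4 * (n % 4)) (%-distribˡ-* m n 4) ⟩
    χ₄ (m % 4 * (n % 4))        ≡⟨ on-residues (odd⇒%4 m m-odd) (odd⇒%4 n n-odd) ⟩
    χ₄ (m % 4) ℤ.* χ₄ (n % 4)   ≡⟨ cong₂ ℤ._*_ (χ₄-cong (m % 4) m (m%n%n≡m%n m 4)) (χ₄-cong (n % 4) n (m%n%n≡m%n n 4)) ⟩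
    χ₄ m ℤ.* χ₄ n               ∎
    where
    open ≡-Reasoning
    on-residues : ∀ {r s} → r ≡ 1 ⊎ r ≡ 3 → s ≡ 1 ⊎ s ≡ 3 → χ₄ (r * s) ≡ χ₄ r ℤ.* χ₄ s
    on-residues (inj₁ refl) (inj₁ refl) = refl
    on-residues (inj₁ refl) (inj₂ refl) = refl
    on-residues (inj₂ refl) (inj₁ refl) = refl
    on-residues (inj₂ refl) (inj₂ refl) = refl

module LegendreSymbol where

  open import Data.Nat as ℕ using (ℕ; zero; suc; _+_; _*_; _∸_; _≤_; _<_; s≤s; s≤s⁻¹; z≤n; _%_; _/_)
  open import Data.Nat.Properties as ℕ using (≤-trans; ≤-refl; ≤-reflexive; <-≤-trans; ≤-<-trans; m≤m+n; 0≢1+n; <-irrefl; ≤-total; ∣-∣-comm; ∣m-n∣≤m⊔n; ∣m-n∣≡0⇒m≡n; m≤n⇒∣m-n∣≡n∸m; +-mono-≤; ≰⇒>; <⇒≤; m<n⇒0<n∸m; ∸-monoʳ-≤; m+n∸m≡n; +-identityʳ; ⊔-lub; m≤n⇒m≤1+n; m≤n⇒m<n∨m≡n)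
  open import Data.Nat.DivMod using (m≡m%n+[m/n]*n; m%n<n; m<n⇒m%n≡m; [m+kn]%n≡m%n)
  import Data.Nat.Divisibility as ℕᵈ
  open import Data.Nat.Coprimality using (coprime-Bézout; prime⇒coprime)
  open import Data.Nat.GCD using (module Bézout)
  open import Data.Nat.Primality using (Prime; euclidsLemma; ¬prime[1])
  open import Data.Integer as ℤ using (ℤ; +_; -_; 1ℤ; _%ℕ_)
  open import Data.Integer.Properties as ℤ using (pos-*; abs-*; [+m]-[+n]≡m⊖n; ∣⊖∣-≤; ∣i-j∣≡∣j-i∣; m-n≡m⊖n; ⊖-≥; *-zeroʳ)
  open import Data.Integer.Divisibility.Signed using (_∣_; divides; ∣ᵤ⇒∣; ∣⇒∣ᵤ; ∣m∣n⇒∣m+n; ∣m∣n⇒∣m-n; ∣n⇒∣m*n; ∣m⇒∣m*n; ∣m⇒∣-m; ∣-refl)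
  open import Data.Integer.Tactic.RingSolver using (solve-∀)
  open import Data.Nat.Tactic.RingSolver using () renaming (solve-∀ to ℕ-solve-∀)
  open import Data.List using (List; []; _∷_; applyUpTo)
  open import Data.List.Properties using (length-applyUpTo)
  open import Data.List.Membership.Propositional using (_∈_)
  open import Data.List.Membership.Propositional.Properties using (∈-applyUpTo⁺; ∈-applyUpTo⁻)
  open import Data.List.Relation.Unary.Any using (here; there)
  open import Data.List.Relation.Unary.All using ([]; _∷_)
  open import Data.List.Relation.Unary.Unique.Propositional using ([]; _∷_)
  open import Data.List.Relation.Unary.Unique.Propositional.Properties using (applyUpTo⁺₁)
  open import Data.Bool using (true; false)
  open import Data.Product using (_×_; _,_; proj₁; proj₂; ∃-syntax; map₂)
  open import Data.Sum as Sum using (_⊎_; inj₁; inj₂; [_,_]′)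
  open import Function using (_∘_; id)
  open import Data.Empty using (⊥-elim)
  open import Relation.Binary.PropositionalEquality
  open import Relation.Nullary using (¬_; yes; no; Dec)
  open import Relation.Nullary.Decidable using (_×-dec_)
  open Involutions ℕ._≟_
  open JacobiSymbol using (χ₄; χ₄-cong)

  prime[1+2h]⇒0<h : ∀ h → Prime (suc (2 * h)) → 0 < h
  prime[1+2h]⇒0<h zero    1-prime = ⊥-elim (¬prime[1] 1-prime)
  prime[1+2h]⇒0<h (suc h) _       = s≤s z≤n

  small-multiple≡0 : ∀ {n p} → n < p → p ℕᵈ.∣ n → n ≡ 0
  small-multiple≡0 {zero}  _   _   = refl
  small-multiple≡0 {suc n} n<p p∣n = ⊥-elim (<-irrefl refl (<-≤-trans n<p (ℕᵈ.∣⇒≤ p∣n)))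

  ∣[+m]-[+n]∣ : ∀ m n → ℤ.∣ + m ℤ.- + n ∣ ≡ ℕ.∣ m - n ∣
  ∣[+m]-[+n]∣ m n with ≤-total m n
  ... | inj₁ m≤n = trans (cong ℤ.∣_∣ ([+m]-[+n]≡m⊖n m n)) (trans (∣⊖∣-≤ m≤n) (sym (m≤n⇒∣m-n∣≡n∸m m≤n)))
  ... | inj₂ n≤m = trans (∣i-j∣≡∣j-i∣ (+ m) (+ n))
                     (trans (cong ℤ.∣_∣ ([+m]-[+n]≡m⊖n n m)) (trans (∣⊖∣-≤ n≤m) (sym (trans (∣-∣-comm m n) (m≤n⇒∣m-n∣≡n∸m n≤m)))))

  module LegendreOfMinusOne (h : ℕ) (p-prime : Prime (suc (2 * h))) where

    p : ℕ
    p = suc (2 * h)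

    P : ℤ
    P = + p

    0<h : 0 < h
    0<h = prime[1+2h]⇒0<h h p-prime

    h<p : h < p
    h<p = s≤s (m≤m+n h (h + 0))

    p∣*⇒ : ∀ x y → P ∣ x ℤ.* y → P ∣ x ⊎ P ∣ y
    p∣*⇒ x y p∣xy = Sum.map ∣ᵤ⇒∣ ∣ᵤ⇒∣ (euclidsLemma ℤ.∣ x ∣ ℤ.∣ y ∣ p-prime (subst (p ℕᵈ.∣_) (abs-* x y) (∣⇒∣ᵤ p∣xy)))

    p∣*-cancelˡ : ∀ {x y} → ¬ P ∣ x → P ∣ x ℤ.* y → P ∣ y
    p∣*-cancelˡ {x} {y} p∤x p∣xy = [ ⊥-elim ∘ p∤x , id ]′ (p∣*⇒ x y p∣xy)

    p∤ : ∀ {a} → 0 < a → a < p → ¬ P ∣ + a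
    p∤ 0<a a<p p∣a with small-multiple≡0 a<p (∣⇒∣ᵤ p∣a)
    ... | refl = <-irrefl refl 0<a

    p∣-⇒≡ : ∀ {a b} → a < p → b < p → P ∣ + a ℤ.- + b → a ≡ b
    p∣-⇒≡ {a} {b} a<p b<p p∣a-b = ∣m-n∣≡0⇒m≡n (small-multiple≡0 (≤-<-trans (∣m-n∣≤m⊔n a b) (⊔-lub a<p b<p))
                                                  (subst (p ℕᵈ.∣_) (∣[+m]-[+n]∣ a b) (∣⇒∣ᵤ p∣a-b)))

    Half : ℕ → Set
    Half s = 0 < s × s ≤ h

    half? : ∀ s → Dec (Half s)
    half? s = (0 ℕ.<? s) ×-dec (s ℕ.≤? h)

    half<p : ∀ {s} → Half s → s < p
    half<p (_ , s≤h) = ≤-<-trans s≤h h<p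

    p∤half : ∀ {s} → Half s → ¬ P ∣ + s
    p∤half hs@(0<s , _) = p∤ 0<s (half<p hs)

    p∤half+half : ∀ {s t} → Half s → Half t → ¬ P ∣ + s ℤ.+ + t
    p∤half+half {s} (0<s , s≤h) (_ , t≤h) = p∤ (<-≤-trans 0<s (m≤m+n s _)) (s≤s (+-mono-≤ s≤h (≤-trans t≤h (m≤m+n h 0))))

    half-1 : Half 1
    half-1 = ≤-refl , 0<h

    +[p∸r] : ∀ {r} → r ≤ p → + (p ∸ r) ≡ P ℤ.- + r
    +[p∸r] {r} r≤p = sym (trans (m-n≡m⊖n p r) (⊖-≥ r≤p))

    fold : ∀ {r} → 0 < r → r < p → Half r ⊎ Half (p ∸ r)
    fold {r} 0<r r<p with r ℕ.≤? h
    ... | yes r≤h = inj₁ (0<r , r≤h)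
    ... | no r≰h = inj₂ (m<n⇒0<n∸m r<p , ≤-trans (∸-monoʳ-≤ p (≰⇒> r≰h)) (≤-reflexive p∸[1+h]≡h))
      where
      p∸[1+h]≡h : p ∸ suc h ≡ h
      p∸[1+h]≡h = trans (m+n∸m≡n h (h + 0)) (+-identityʳ h)

    1<p : 1 < p
    1<p = <-≤-trans (s≤s 0<h) h<p

    Bézout-toℤ : ∀ {a b c d} → 1 + a * b ≡ c * d → 1ℤ ℤ.+ + a ℤ.* + b ≡ + c ℤ.* + d
    Bézout-toℤ {a} {b} {c} {d} eq = trans (cong (λ z → 1ℤ ℤ.+ z) (sym (pos-* a b))) (trans (cong +_ eq) (pos-* c d))

    ±Inverse : ℕ → ℕ → Set
    ±Inverse s t = P ∣ + s ℤ.* + t ℤ.- 1ℤ ⊎ P ∣ + s ℤ.* + t ℤ.+ 1ℤ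

    ±Inverse-sym : ∀ {s t} → ±Inverse s t → ±Inverse t s
    ±Inverse-sym {s} {t} = subst (λ x → P ∣ x ℤ.- 1ℤ ⊎ P ∣ x ℤ.+ 1ℤ) (ℤ.*-comm (+ s) (+ t))

    Bézout-±Inverse : ∀ {s} → Half s → ∃[ x ] ±Inverse s x
    Bézout-±Inverse {s@(suc _)} hs with coprime-Bézout (prime⇒coprime p-prime (half<p hs))
    ... | Bézout.+- x y 1+ys≡xp = y , inj₂ (divides (+ x) (trans (swap (+ s) (+ y)) (Bézout-toℤ {y} {s} {x} {p} 1+ys≡xp)))
      where
      swap : ∀ S Y → S ℤ.* Y ℤ.+ 1ℤ ≡ 1ℤ ℤ.+ Y ℤ.* S
      swap = solve-∀
    ... | Bézout.-+ x y 1+xp≡ys = y , inj₁ (divides (+ x) (begin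
      + s ℤ.* + y ℤ.- 1ℤ              ≡⟨ cong (ℤ._- 1ℤ) (trans (ℤ.*-comm (+ s) (+ y)) (sym (Bézout-toℤ {x} {p} {y} {s} 1+xp≡ys))) ⟩
      1ℤ ℤ.+ + x ℤ.* P ℤ.- 1ℤ         ≡⟨ cancel (+ x ℤ.* P) ⟩
      + x ℤ.* P                       ∎))
      where
      open ≡-Reasoning
      cancel : ∀ Z → 1ℤ ℤ.+ Z ℤ.- 1ℤ ≡ Z
      cancel = solve-∀

    ±Inverse-cong : ∀ {s x y} → P ∣ + x ℤ.- + y → ±Inverse s x → ±Inverse s y
    ±Inverse-cong {s} {x} {y} p∣x-y = Sum.map (shift (ℤ.- 1ℤ)) (shift 1ℤ)
      where
      shift : ∀ e → P ∣ + s ℤ.* + x ℤ.+ e → P ∣ + s ℤ.* + y ℤ.+ e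
      shift e p∣ = subst (P ∣_) (eq (+ s) (+ x) (+ y) e) (∣m∣n⇒∣m-n p∣ (∣n⇒∣m*n (+ s) p∣x-y))
        where
        eq : ∀ S X Y E → (S ℤ.* X ℤ.+ E) ℤ.- S ℤ.* (X ℤ.- Y) ≡ S ℤ.* Y ℤ.+ E
        eq = solve-∀

    ±Inverse-flip : ∀ {s r} → r ≤ p → ±Inverse s r → ±Inverse s (p ∸ r)
    ±Inverse-flip {s} {r} r≤p (inj₁ p∣sr-1) =
      inj₂ (subst (λ z → P ∣ + s ℤ.* z ℤ.+ 1ℤ) (sym (+[p∸r] r≤p))
             (subst (P ∣_) (eq (+ s) (+ r) P) (∣m∣n⇒∣m-n (∣n⇒∣m*n (+ s) ∣-refl) p∣sr-1)))
      where
      eq : ∀ S R Q → S ℤ.* Q ℤ.- (S ℤ.* R ℤ.- 1ℤ) ≡ S ℤ.* (Q ℤ.- R) ℤ.+ 1ℤ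
      eq = solve-∀
    ±Inverse-flip {s} {r} r≤p (inj₂ p∣sr+1) =
      inj₁ (subst (λ z → P ∣ + s ℤ.* z ℤ.- 1ℤ) (sym (+[p∸r] r≤p))
             (subst (P ∣_) (eq (+ s) (+ r) P) (∣m∣n⇒∣m-n (∣n⇒∣m*n (+ s) ∣-refl) p∣sr+1)))
      where
      eq : ∀ S R Q → S ℤ.* Q ℤ.- (S ℤ.* R ℤ.+ 1ℤ) ≡ S ℤ.* (Q ℤ.- R) ℤ.- 1ℤ
      eq = solve-∀

    ¬±Inverse-0 : ∀ {s} → ¬ ±Inverse s 0
    ¬±Inverse-0 {s} inv rewrite *-zeroʳ (+ s) with inv
    ... | inj₁ p∣-1 = p∤ (s≤s z≤n) 1<p (∣m⇒∣-m p∣-1)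
    ... | inj₂ p∣1  = p∤ (s≤s z≤n) 1<p p∣1

    p∣x-[x%p] : ∀ x → P ∣ + x ℤ.- + (x % p)
    p∣x-[x%p] x = divides (+ (x / p)) (begin
      + x ℤ.- + (x % p)                              ≡⟨ cong (λ z → + z ℤ.- + (x % p)) (m≡m%n+[m/n]*n x p) ⟩
      + (x % p + x / p * p) ℤ.- + (x % p)            ≡⟨ cong (λ z → + (x % p) ℤ.+ z ℤ.- + (x % p)) (pos-* (x / p) p) ⟩
      + (x % p) ℤ.+ + (x / p) ℤ.* P ℤ.- + (x % p)    ≡⟨ cancel (+ (x % p)) (+ (x / p) ℤ.* P) ⟩
      + (x / p) ℤ.* P                                ∎)
      where
      open ≡-Reasoning
      cancel : ∀ R Z → R ℤ.+ Z ℤ.- R ≡ Z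
      cancel = solve-∀

    ±Inverse-exists : ∀ {s} → Half s → ∃[ t ] Half t × ±Inverse s t
    ±Inverse-exists {s} hs with Bézout-±Inverse hs
    ... | x , inv = reduce (x % p) (m%n<n x p) (±Inverse-cong {s} {x} (p∣x-[x%p] x) inv)
      where
      reduce : ∀ r → r < p → ±Inverse s r → ∃[ t ] Half t × ±Inverse s t
      reduce zero      _   inv₀ = ⊥-elim (¬±Inverse-0 {s} inv₀)
      reduce r@(suc _) r<p invᵣ with fold (s≤s z≤n) r<p
      ... | inj₁ hr   = r , hr , invᵣ
      ... | inj₂ hp-r = p ∸ r , hp-r , ±Inverse-flip {s} {r} (<⇒≤ r<p) invᵣ

    difference-of-squares : ∀ X → (X ℤ.- 1ℤ) ℤ.* (X ℤ.+ 1ℤ) ≡ X ℤ.* X ℤ.- 1ℤ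
    difference-of-squares = solve-∀

    ±Inverse⇒square : ∀ {s t} → ±Inverse s t → P ∣ (+ s ℤ.* + t) ℤ.* (+ s ℤ.* + t) ℤ.- 1ℤ
    ±Inverse⇒square {s} {t} (inj₁ p∣st-1) = subst (P ∣_) (difference-of-squares (+ s ℤ.* + t)) (∣m⇒∣m*n (+ s ℤ.* + t ℤ.+ 1ℤ) p∣st-1)
    ±Inverse⇒square {s} {t} (inj₂ p∣st+1) = subst (P ∣_) (difference-of-squares (+ s ℤ.* + t)) (∣n⇒∣m*n (+ s ℤ.* + t ℤ.- 1ℤ) p∣st+1)

    -- (s t)² ≡ 1 ≡ (s t′)² forces p ∣ s² (t − t′)(t + t′)
    ±Inverse-unique : ∀ {s t t′} → Half s → Half t → Half t′ → ±Inverse s t → ±Inverse s t′ → t ≡ t′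
    ±Inverse-unique {s} {t} {t′} hs ht ht′ inv inv′ =
      [ p∣-⇒≡ (half<p ht) (half<p ht′) , ⊥-elim ∘ p∤half+half ht ht′ ]′
        (p∣*⇒ _ _ (p∣*-cancelˡ (p∤half hs) (p∣*-cancelˡ (p∤half hs) p∣s²[t-t′][t+t′])))
      where
      factor : ∀ S T T′ → (S ℤ.* T ℤ.* (S ℤ.* T) ℤ.- 1ℤ) ℤ.- (S ℤ.* T′ ℤ.* (S ℤ.* T′) ℤ.- 1ℤ)
                        ≡ S ℤ.* (S ℤ.* ((T ℤ.- T′) ℤ.* (T ℤ.+ T′)))
      factor = solve-∀
      p∣s²[t-t′][t+t′] : P ∣ + s ℤ.* (+ s ℤ.* ((+ t ℤ.- + t′) ℤ.* (+ t ℤ.+ + t′)))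
      p∣s²[t-t′][t+t′] = subst (P ∣_) (factor (+ s) (+ t) (+ t′))
                           (∣m∣n⇒∣m-n (±Inverse⇒square {s} inv) (±Inverse⇒square {s} inv′))

    IsSqrt-1 : ℕ → Set
    IsSqrt-1 k = P ∣ + k ℤ.* + k ℤ.+ 1ℤ

    ±Inverse-self : ∀ {s} → Half s → ±Inverse s s → s ≡ 1 ⊎ IsSqrt-1 s
    ±Inverse-self {s} hs (inj₁ p∣s²-1) =
      inj₁ ([ p∣-⇒≡ (half<p hs) 1<p , ⊥-elim ∘ p∤half+half hs half-1 ]′
              (p∣*⇒ _ _ (subst (P ∣_) (sym (difference-of-squares (+ s))) p∣s²-1)))
    ±Inverse-self hs (inj₂ s²≡-1) = inj₂ s²≡-1

    IsSqrt-1-unique : ∀ {s t} → Half s → Half t → IsSqrt-1 s → IsSqrt-1 t → s ≡ t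
    IsSqrt-1-unique {s} {t} hs ht s²≡-1 t²≡-1 =
      [ p∣-⇒≡ (half<p hs) (half<p ht) , ⊥-elim ∘ p∤half+half hs ht ]′
        (p∣*⇒ _ _ (subst (P ∣_) (factor (+ s) (+ t)) (∣m∣n⇒∣m-n s²≡-1 t²≡-1)))
      where
      factor : ∀ S T → (S ℤ.* S ℤ.+ 1ℤ) ℤ.- (T ℤ.* T ℤ.+ 1ℤ) ≡ (S ℤ.- T) ℤ.* (S ℤ.+ T)
      factor = solve-∀

    IsSqrt-1-fold : ∀ {k} → k < p → IsSqrt-1 k → ∃[ x ] Half x × IsSqrt-1 x
    IsSqrt-1-fold {zero}      _   p∣1    = ⊥-elim (p∤ (s≤s z≤n) 1<p p∣1)
    IsSqrt-1-fold {k@(suc _)} k<p k²≡-1 with fold (s≤s z≤n) k<p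
    ... | inj₁ hk   = k , hk , k²≡-1
    ... | inj₂ hp-k = p ∸ k , hp-k , subst (λ z → P ∣ z ℤ.* z ℤ.+ 1ℤ) (sym (+[p∸r] (<⇒≤ k<p)))
                                       (subst (P ∣_) (sym (expand P (+ k))) (∣m∣n⇒∣m+n k²≡-1 (∣n⇒∣m*n (P ℤ.- + k ℤ.- + k) ∣-refl)))
      where
      expand : ∀ Q K → (Q ℤ.- K) ℤ.* (Q ℤ.- K) ℤ.+ 1ℤ ≡ (K ℤ.* K ℤ.+ 1ℤ) ℤ.+ (Q ℤ.- K ℤ.- K) ℤ.* Q
      expand = solve-∀

    partner : ℕ → ℕ
    partner s with half? s
    ... | yes hs = proj₁ (±Inverse-exists hs)
    ... | no  _  = s

    partner-spec : ∀ {s} → Half s → Half (partner s) × ±Inverse s (partner s)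
    partner-spec {s} hs with half? s
    ... | yes hs′ = proj₂ (±Inverse-exists hs′)
    ... | no ¬hs  = ⊥-elim (¬hs hs)

    partner-involutive : ∀ {s} → Half s → partner (partner s) ≡ s
    partner-involutive {s} hs =
      let ht , inv = partner-spec hs
          htt , inv′ = partner-spec ht
      in ±Inverse-unique ht htt hs inv′ (±Inverse-sym {s} inv)

    partner-fixed⇒ : ∀ {s} → Half s → partner s ≡ s → ±Inverse s s
    partner-fixed⇒ {s} hs fixed = subst (±Inverse s) fixed (proj₂ (partner-spec hs))

    ⇒partner-fixed : ∀ {s} → Half s → ±Inverse s s → partner s ≡ s
    ⇒partner-fixed {s} hs inv = let ht , inv′ = partner-spec hs in ±Inverse-unique hs ht hs inv′ inv

    halves : List ℕ
    halves = applyUpTo suc h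

    ∈-halves⁻ : ∀ {s} → s ∈ halves → Half s
    ∈-halves⁻ s∈ with ∈-applyUpTo⁻ suc s∈
    ... | i , i<h , refl = s≤s z≤n , i<h

    ∈-halves⁺ : ∀ {s} → Half s → s ∈ halves
    ∈-halves⁺ {suc i} (_ , i<h) = ∈-applyUpTo⁺ suc i<h

    partner-involution : IsInvolutionOn partner halves
    partner-involution = record
      { unique     = applyUpTo⁺₁ suc h (λ i<j _ → ℕ.<⇒≢ (s≤s i<j))
      ; closed     = ∈-halves⁺ ∘ proj₁ ∘ partner-spec ∘ ∈-halves⁻
      ; involutive = partner-involutive ∘ ∈-halves⁻
      }

    1²≡1 : ±Inverse 1 1
    1²≡1 = inj₁ (divides (+ 0) refl)

    fixed-points-without-root : (∀ {x} → Half x → ¬ IsSqrt-1 x) → FixedPointsOf partner halves (1 ∷ [])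
    fixed-points-without-root no-root = record
      { unique   = [] ∷ []
      ; sound    = λ { (here refl) → ∈-halves⁺ half-1 , ⇒partner-fixed half-1 1²≡1 }
      ; complete = λ s∈ fixed → let hs = ∈-halves⁻ s∈ in
                     [ here , ⊥-elim ∘ no-root hs ]′ (±Inverse-self hs (partner-fixed⇒ hs fixed))
      }

    fixed-points-with-root : ∀ {x} → Half x → IsSqrt-1 x → FixedPointsOf partner halves (1 ∷ x ∷ [])
    fixed-points-with-root {x} hx x²≡-1 = record
      { unique   = (1≢x ∷ []) ∷ [] ∷ []
      ; sound    = λ { (here refl) → ∈-halves⁺ half-1 , ⇒partner-fixed half-1 1²≡1
                     ; (there (here refl)) → ∈-halves⁺ hx , ⇒partner-fixed hx (inj₂ x²≡-1) }
      ; complete = λ s∈ fixed → let hs = ∈-halves⁻ s∈ in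
                     [ here , (λ s²≡-1 → there (here (IsSqrt-1-unique hs hx s²≡-1 x²≡-1))) ]′
                       (±Inverse-self hs (partner-fixed⇒ hs fixed))
      }
      where
      1≢x : 1 ≢ x
      1≢x refl = p∤ (s≤s z≤n) (s≤s (+-mono-≤ 0<h (≤-trans 0<h (m≤m+n h 0)))) x²≡-1

    h-odd-without-root : (∀ {x} → Half x → ¬ IsSqrt-1 x) → ∃[ k ] h ≡ 1 + 2 * k
    h-odd-without-root no-root =
      map₂ (trans (sym (length-applyUpTo suc h))) (involution-parity partner-involution (fixed-points-without-root no-root))

    h-even-with-root : ∀ {x} → Half x → IsSqrt-1 x → ∃[ k ] h ≡ 2 + 2 * k
    h-even-with-root hx x²≡-1 =
      map₂ (trans (sym (length-applyUpTo suc h))) (involution-parity partner-involution (fixed-points-with-root hx x²≡-1))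

    sq+1 : ∀ k → + k ℤ.* + k ℤ.+ 1ℤ ≡ + (k * k + 1)
    sq+1 k = cong (ℤ._+ 1ℤ) (sym (pos-* k k))

    %≡0⇒IsSqrt-1 : ∀ k → (+ k ℤ.* + k ℤ.- - 1ℤ) %ℕ p ≡ 0 → IsSqrt-1 k
    %≡0⇒IsSqrt-1 k r≡0 = subst (P ∣_) (sym (sq+1 k)) (∣ᵤ⇒∣ (ℕᵈ.m%n≡0⇒n∣m _ p (subst (λ z → z %ℕ p ≡ 0) (sq+1 k) r≡0)))

    IsSqrt-1⇒%≡0 : ∀ k → IsSqrt-1 k → (+ k ℤ.* + k ℤ.- - 1ℤ) %ℕ p ≡ 0
    IsSqrt-1⇒%≡0 k k²≡-1 = subst (λ z → z %ℕ p ≡ 0) (sym (sq+1 k)) (ℕᵈ.n∣m⇒m%n≡0 _ p (∣⇒∣ᵤ (subst (P ∣_) (sq+1 k) k²≡-1)))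

    isSquareMod-true : ∀ j → isSquareMod (- 1ℤ) p j ≡ true → ∃[ k ] k < j × IsSqrt-1 k
    isSquareMod-true (suc j) found with (+ j ℤ.* + j ℤ.- - 1ℤ) %ℕ p in r≡
    ... | zero  = j , ≤-refl , %≡0⇒IsSqrt-1 j r≡
    ... | suc _ = let k , k<j , k²≡-1 = isSquareMod-true j found in k , m≤n⇒m≤1+n k<j , k²≡-1

    isSquareMod-false : ∀ j → isSquareMod (- 1ℤ) p j ≡ false → ∀ {k} → k < j → ¬ IsSqrt-1 k
    isSquareMod-false (suc j) not-found {k} k<1+j k²≡-1 with (+ j ℤ.* + j ℤ.- - 1ℤ) %ℕ p in r≡
    isSquareMod-false (suc j) () _ _ | zero
    ... | suc _ with m≤n⇒m<n∨m≡n (s≤s⁻¹ k<1+j)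
    ...   | inj₁ k<j  = isSquareMod-false j not-found k<j k²≡-1
    ...   | inj₂ refl = 0≢1+n (trans (sym (IsSqrt-1⇒%≡0 k k²≡-1)) r≡)

    -1%p≡2h : (- 1ℤ) %ℕ p ≡ 2 * h
    -1%p≡2h rewrite m<n⇒m%n≡m 1<p = refl

    p%4≡3 : ∃[ k ] h ≡ 1 + 2 * k → p % 4 ≡ 3
    p%4≡3 (k , h≡) = trans (cong (λ n → suc (2 * n) % 4) h≡) (trans (cong (_% 4) (eq k)) ([m+kn]%n≡m%n 3 k 4))
      where
      eq : ∀ k → suc (2 * (1 + 2 * k)) ≡ 3 + k * 4
      eq = ℕ-solve-∀

    p%4≡1 : ∃[ k ] h ≡ 2 + 2 * k → p % 4 ≡ 1
    p%4≡1 (k , h≡) = trans (cong (λ n → suc (2 * n) % 4) h≡) (trans (cong (_% 4) (eq k)) ([m+kn]%n≡m%n 1 (suc k) 4))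
      where
      eq : ∀ k → suc (2 * (2 + 2 * k)) ≡ 1 + suc k * 4
      eq = ℕ-solve-∀

    legendre-1≡χ₄ : legendre (- 1ℤ) p ≡ χ₄ p
    legendre-1≡χ₄ with (- 1ℤ) %ℕ p | -1%p≡2h
    ... | zero  | 0≡2h = ⊥-elim (<-irrefl 0≡2h (<-≤-trans 0<h (m≤m+n h _)))
    ... | suc _ | _ with isSquareMod (- 1ℤ) p p in found?
    ...   | true  = let k , k<p , k²≡-1 = isSquareMod-true p found?
                        x , hx , x²≡-1 = IsSqrt-1-fold k<p k²≡-1
                    in sym (χ₄-cong p 1 (p%4≡1 (h-even-with-root hx x²≡-1)))
    ...   | false = sym (χ₄-cong p 3 (p%4≡3 (h-odd-without-root λ hx → isSquareMod-false p found? (half<p hx))))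

  legendre-1≡χ₄ : ∀ {q} → Prime (suc q) → suc q % 2 ≡ 1 → legendre (- 1ℤ) (suc q) ≡ χ₄ (suc q)
  legendre-1≡χ₄ {q} p-prime p-odd = subst (λ n → legendre (- 1ℤ) (suc n) ≡ χ₄ (suc n)) (sym q≡2h)
                                  (LegendreOfMinusOne.legendre-1≡χ₄ h (subst (Prime ∘ suc) q≡2h p-prime))
    where
    h = suc q / 2
    q≡2h : q ≡ 2 * h
    q≡2h = trans (ℕ.suc-injective (trans (m≡m%n+[m/n]*n (suc q) 2) (cong (_+ h * 2) p-odd))) (ℕ.*-comm h 2)

module PellEquation where

  open import Data.Nat as ℕ using (ℕ; zero; suc; _+_; _*_; _∸_; _≤_; _<_; s≤s)
  import Data.Nat.Properties as ℕ
  open import Data.Nat.Induction using (<-rec)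
  open import Data.Nat.Tactic.RingSolver using () renaming (solve-∀ to ℕ-solve-∀)
  open import Data.Integer as ℤ using (ℤ; +_; -_; -[1+_]; 1ℤ; 0ℤ)
  open import Data.Integer.Properties as ℤ using (pos-*; m-n≡m⊖n; ⊖-≥)
  open import Data.Integer.Tactic.RingSolver using (solve-∀)
  open import Data.Product using (_×_; _,_; ∃-syntax)
  open import Data.Empty using (⊥-elim)
  open import Relation.Binary.PropositionalEquality
  open import Relation.Nullary using (yes; no)

  square-≤⇒≤ : ∀ {m n} → m * m ≤ n * n → m ≤ n
  square-≤⇒≤ {m} {n} m²≤n² with m ℕ.≤? n
  ... | yes m≤n = m≤n
  ... | no m≰n = let n<m = ℕ.≰⇒> m≰n in ⊥-elim (ℕ.<⇒≱ (ℕ.*-mono-< n<m n<m) m²≤n²)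

  square-<⇒< : ∀ {m n} → m * m < n * n → m < n
  square-<⇒< {m} {n} m²<n² with m ℕ.<? n
  ... | yes m<n = m<n
  ... | no m≮n = let n≤m = ℕ.≮⇒≥ m≮n in ⊥-elim (ℕ.<⇒≱ m²<n² (ℕ.*-mono-≤ n≤m n≤m))

  Pell : ℤ → ℤ → Set
  Pell U V = U ℤ.* U ℤ.- + 2 ℤ.* V ℤ.* V ≡ 1ℤ

  -- U + V√2 ≡ 1 or 3 + 2√2 (mod 4)
  PellResidue : ℤ → ℤ → Set
  PellResidue U V = ∃[ k ] ∃[ m ] V ≡ + 2 ℤ.* k × U ≡ 1ℤ ℤ.+ + 4 ℤ.* m ℤ.- + 2 ℤ.* k

  PellResidue-neg : ∀ {U V} → PellResidue U V → PellResidue U (- V)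
  PellResidue-neg (k , m , refl , refl) = - k , m ℤ.- k , eq₁ k , eq₂ k m
    where
    eq₁ : ∀ k → - (+ 2 ℤ.* k) ≡ + 2 ℤ.* (- k)
    eq₁ = solve-∀
    eq₂ : ∀ k m → 1ℤ ℤ.+ + 4 ℤ.* m ℤ.- + 2 ℤ.* k ≡ 1ℤ ℤ.+ + 4 ℤ.* (m ℤ.- k) ℤ.- + 2 ℤ.* (- k)
    eq₂ = solve-∀

  -- (U + V√2)(3 − 2√2) = (3U − 4V) + (3V − 2U)√2
  Pell-step : ∀ {U V} → Pell U V → Pell (+ 3 ℤ.* U ℤ.- + 4 ℤ.* V) (+ 3 ℤ.* V ℤ.- + 2 ℤ.* U)
  Pell-step {U} {V} = trans (invariant U V)
    where
    invariant : ∀ U V → (+ 3 ℤ.* U ℤ.- + 4 ℤ.* V) ℤ.* (+ 3 ℤ.* U ℤ.- + 4 ℤ.* V) ℤ.- + 2 ℤ.* (+ 3 ℤ.* V ℤ.- + 2 ℤ.* U) ℤ.* (+ 3 ℤ.* V ℤ.- + 2 ℤ.* U)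
                      ≡ U ℤ.* U ℤ.- + 2 ℤ.* V ℤ.* V
    invariant = solve-∀

  PellResidue-step : ∀ {U V} → PellResidue (+ 3 ℤ.* U ℤ.- + 4 ℤ.* V) (+ 3 ℤ.* V ℤ.- + 2 ℤ.* U) → PellResidue U V
  PellResidue-step {U} {V} (k , m , V′≡ , U′≡) = 1ℤ ℤ.+ + 4 ℤ.* m ℤ.+ k , 1ℤ ℤ.+ + 5 ℤ.* m ℤ.+ k , V≡ , U≡
    where
    open ≡-Reasoning
    U′ = + 3 ℤ.* U ℤ.- + 4 ℤ.* V
    V′ = + 3 ℤ.* V ℤ.- + 2 ℤ.* U
    U≡3U′+4V′ : ∀ U V → U ≡ + 3 ℤ.* (+ 3 ℤ.* U ℤ.- + 4 ℤ.* V) ℤ.+ + 4 ℤ.* (+ 3 ℤ.* V ℤ.- + 2 ℤ.* U)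
    U≡3U′+4V′ = solve-∀
    V≡2U′+3V′ : ∀ U V → V ≡ + 2 ℤ.* (+ 3 ℤ.* U ℤ.- + 4 ℤ.* V) ℤ.+ + 3 ℤ.* (+ 3 ℤ.* V ℤ.- + 2 ℤ.* U)
    V≡2U′+3V′ = solve-∀
    eq₁ : ∀ k m → + 2 ℤ.* (1ℤ ℤ.+ + 4 ℤ.* m ℤ.- + 2 ℤ.* k) ℤ.+ + 3 ℤ.* (+ 2 ℤ.* k) ≡ + 2 ℤ.* (1ℤ ℤ.+ + 4 ℤ.* m ℤ.+ k)
    eq₁ = solve-∀
    eq₂ : ∀ k m → + 3 ℤ.* (1ℤ ℤ.+ + 4 ℤ.* m ℤ.- + 2 ℤ.* k) ℤ.+ + 4 ℤ.* (+ 2 ℤ.* k)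
                ≡ 1ℤ ℤ.+ + 4 ℤ.* (1ℤ ℤ.+ + 5 ℤ.* m ℤ.+ k) ℤ.- + 2 ℤ.* (1ℤ ℤ.+ + 4 ℤ.* m ℤ.+ k)
    eq₂ = solve-∀
    V≡ : V ≡ + 2 ℤ.* (1ℤ ℤ.+ + 4 ℤ.* m ℤ.+ k)
    V≡ = begin
      V                                   ≡⟨ V≡2U′+3V′ U V ⟩
      + 2 ℤ.* U′ ℤ.+ + 3 ℤ.* V′           ≡⟨ cong₂ (λ X Y → + 2 ℤ.* X ℤ.+ + 3 ℤ.* Y) U′≡ V′≡ ⟩
      + 2 ℤ.* (1ℤ ℤ.+ + 4 ℤ.* m ℤ.- + 2 ℤ.* k) ℤ.+ + 3 ℤ.* (+ 2 ℤ.* k) ≡⟨ eq₁ k m ⟩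
      + 2 ℤ.* (1ℤ ℤ.+ + 4 ℤ.* m ℤ.+ k)    ∎
    U≡ : U ≡ 1ℤ ℤ.+ + 4 ℤ.* (1ℤ ℤ.+ + 5 ℤ.* m ℤ.+ k) ℤ.- + 2 ℤ.* (1ℤ ℤ.+ + 4 ℤ.* m ℤ.+ k)
    U≡ = begin
      U                                   ≡⟨ U≡3U′+4V′ U V ⟩
      + 3 ℤ.* U′ ℤ.+ + 4 ℤ.* V′           ≡⟨ cong₂ (λ X Y → + 3 ℤ.* X ℤ.+ + 4 ℤ.* Y) U′≡ V′≡ ⟩
      + 3 ℤ.* (1ℤ ℤ.+ + 4 ℤ.* m ℤ.- + 2 ℤ.* k) ℤ.+ + 4 ℤ.* (+ 2 ℤ.* k) ≡⟨ eq₂ k m ⟩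
      1ℤ ℤ.+ + 4 ℤ.* (1ℤ ℤ.+ + 5 ℤ.* m ℤ.+ k) ℤ.- + 2 ℤ.* (1ℤ ℤ.+ + 4 ℤ.* m ℤ.+ k) ∎

  Pell-ℕ : ∀ {u n} → Pell (+ u) (+ n) → u * u ≡ 1 + 2 * n * n
  Pell-ℕ {u} {n} pell = ℤ.+-injective (begin
    + (u * u)                                 ≡⟨ pos-* u u ⟩
    + u ℤ.* + u                               ≡⟨ rearrange (+ u) (+ n) ⟩
    (+ u ℤ.* + u ℤ.- + 2 ℤ.* + n ℤ.* + n) ℤ.+ + 2 ℤ.* + n ℤ.* + n ≡⟨ cong (ℤ._+ + 2 ℤ.* + n ℤ.* + n) pell ⟩
    1ℤ ℤ.+ + 2 ℤ.* + n ℤ.* + n                ≡⟨ cong (λ z → 1ℤ ℤ.+ z) (sym (trans (pos-* (2 * n) n) (cong (ℤ._* + n) (pos-* 2 n)))) ⟩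
    + (1 + 2 * n * n)                         ∎)
    where
    open ≡-Reasoning
    rearrange : ∀ U N → U ℤ.* U ≡ (U ℤ.* U ℤ.- + 2 ℤ.* N ℤ.* N) ℤ.+ + 2 ℤ.* N ℤ.* N
    rearrange = solve-∀

  -- (u + N√2)(3 − 2√2) = u′ + N′√2 with 0 ≤ u′ < u
  pell-descent : ∀ {u n} → Pell (+ u) (+ suc n) → ∃[ u′ ] u′ < u × + u′ ≡ + 3 ℤ.* + u ℤ.- + 4 ℤ.* + suc n
  pell-descent {u} {n} pell = 3 * u ∸ 4 * N , u′<u , +u′≡
    where
    N = suc n
    u²≡ : u * u ≡ 1 + 2 * N * N
    u²≡ = Pell-ℕ {u} {N} pell
    4N≤3u : 4 * N ≤ 3 * u
    4N≤3u = square-≤⇒≤ (ℕ.≤-trans (ℕ.m≤m+n _ (9 + 2 * N * N)) (ℕ.≤-reflexive (begin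
      4 * N * (4 * N) + (9 + 2 * N * N)  ≡⟨ eq₁ N ⟩
      9 * (1 + 2 * N * N)                ≡⟨ cong (9 *_) u²≡ ⟨
      9 * (u * u)                        ≡⟨ eq₂ u ⟩
      3 * u * (3 * u)                    ∎)))
      where
      open ≡-Reasoning
      eq₁ : ∀ N → 4 * N * (4 * N) + (9 + 2 * N * N) ≡ 9 * (1 + 2 * N * N)
      eq₁ = ℕ-solve-∀
      eq₂ : ∀ u → 9 * (u * u) ≡ 3 * u * (3 * u)
      eq₂ = ℕ-solve-∀
    u<2N : u < 2 * N
    u<2N = square-<⇒< (ℕ.≤-trans (s≤s (ℕ.m≤m+n (u * u) (2 * n * n + 4 * n))) (ℕ.≤-reflexive (begin
      suc (u * u + (2 * n * n + 4 * n))             ≡⟨ cong (λ x → suc (x + (2 * n * n + 4 * n))) u²≡ ⟩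
      suc (1 + 2 * N * N + (2 * n * n + 4 * n))     ≡⟨ eq n ⟩
      2 * N * (2 * N)                               ∎)))
      where
      open ≡-Reasoning
      eq : ∀ n → suc (1 + 2 * suc n * suc n + (2 * n * n + 4 * n)) ≡ 2 * suc n * (2 * suc n)
      eq = ℕ-solve-∀
    u′<u : 3 * u ∸ 4 * N < u
    u′<u = subst (3 * u ∸ 4 * N <_) (eq u) (ℕ.∸-monoʳ-< (subst (2 * u <_) (eq′ N) (ℕ.*-monoʳ-< 2 u<2N)) 4N≤3u)
      where
      eq : ∀ u → 3 * u ∸ 2 * u ≡ u
      eq u = trans (cong (_∸ 2 * u) (ℕ.+-comm u (2 * u))) (ℕ.m+n∸m≡n (2 * u) u)
      eq′ : ∀ N → 2 * (2 * N) ≡ 4 * N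
      eq′ = ℕ-solve-∀
    +u′≡ : + (3 * u ∸ 4 * N) ≡ + 3 ℤ.* + u ℤ.- + 4 ℤ.* + N
    +u′≡ = sym (trans (cong₂ ℤ._-_ (sym (pos-* 3 u)) (sym (pos-* 4 N))) (trans (m-n≡m⊖n (3 * u) (4 * N)) (⊖-≥ 4N≤3u)))

  pell⇒PellResidue : ∀ u V → Pell (+ u) V → PellResidue (+ u) V
  pell⇒PellResidue = <-rec (λ u → ∀ V → Pell (+ u) V → PellResidue (+ u) V) descend
    where
    Below : ℕ → Set
    Below u = ∀ {u′} → u′ < u → ∀ V → Pell (+ u′) V → PellResidue (+ u′) V

    positive : ∀ u → Below u → ∀ n → Pell (+ u) (+ suc n) → PellResidue (+ u) (+ suc n)
    positive u rec n pell = descended (pell-descent {u} {n} pell)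
      where
      V′ = + 3 ℤ.* + suc n ℤ.- + 2 ℤ.* + u
      descended : ∃[ u′ ] u′ < u × + u′ ≡ + 3 ℤ.* + u ℤ.- + 4 ℤ.* + suc n → PellResidue (+ u) (+ suc n)
      descended (u′ , u′<u , +u′≡) = PellResidue-step {+ u} {+ suc n}
        (subst (λ U′ → PellResidue U′ V′) +u′≡ (rec u′<u V′ (subst (λ U′ → Pell U′ V′) (sym +u′≡) (Pell-step {+ u} {+ suc n} pell))))

    descend : ∀ u → Below u → ∀ V → Pell (+ u) V → PellResidue (+ u) V
    descend u _   (+ zero)  pell with ℕ.m*n≡1⇒m≡1 u u (Pell-ℕ {u} {0} pell)
    ... | refl = 0ℤ , 0ℤ , refl , refl
    descend u rec (+ suc n) pell = positive u rec n pell
    descend u rec -[1+ n ]  pell = PellResidue-neg (positive u rec n (trans (flip (+ u) (+ suc n)) pell))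
      where
      flip : ∀ U N → U ℤ.* U ℤ.- + 2 ℤ.* N ℤ.* N ≡ U ℤ.* U ℤ.- + 2 ℤ.* (- N) ℤ.* (- N)
      flip = solve-∀

module IntegerParity where

  open import Data.Nat using (suc; s≤s)
  import Data.Nat.Divisibility as ℕᵈ
  open import Data.Integer as ℤ using (ℤ; +_; 1ℤ; 0ℤ; _%ℕ_; _/ℕ_)
  import Data.Integer.Properties as ℤ
  open import Data.Integer.DivMod using (a≡a%ℕn+[a/ℕn]*n; n%ℕd<d)
  open import Data.Integer.Divisibility.Signed using (divides; ∣⇒∣ᵤ)
  open import Data.Integer.Tactic.RingSolver using (solve-∀)
  open import Data.Product using (_,_; ∃-syntax)
  open import Data.Sum using (_⊎_; inj₁; inj₂)
  open import Data.Empty using (⊥-elim)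
  open import Relation.Binary.PropositionalEquality
  open import Relation.Nullary using (¬_)

  Even Odd : ℤ → Set
  Even z = ∃[ k ] z ≡ + 2 ℤ.* k
  Odd  z = ∃[ k ] z ≡ 1ℤ ℤ.+ + 2 ℤ.* k

  even⇒¬odd : ∀ {z} → Even z → ¬ Odd z
  even⇒¬odd (k , refl) (l , 2k≡1+2l) = 2≢1 (ℕᵈ.∣1⇒≡1 (∣⇒∣ᵤ (divides (k ℤ.- l) (begin
    1ℤ                                ≡⟨ eq₁ l ⟩
    (1ℤ ℤ.+ + 2 ℤ.* l) ℤ.- + 2 ℤ.* l  ≡⟨ cong (ℤ._- + 2 ℤ.* l) 2k≡1+2l ⟨
    + 2 ℤ.* k ℤ.- + 2 ℤ.* l           ≡⟨ eq₂ k l ⟩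
    (k ℤ.- l) ℤ.* + 2                 ∎))))
    where
    open ≡-Reasoning
    2≢1 : 2 ≢ 1
    2≢1 ()
    eq₁ : ∀ l → 1ℤ ≡ (1ℤ ℤ.+ + 2 ℤ.* l) ℤ.- + 2 ℤ.* l
    eq₁ = solve-∀
    eq₂ : ∀ k l → + 2 ℤ.* k ℤ.- + 2 ℤ.* l ≡ (k ℤ.- l) ℤ.* + 2
    eq₂ = solve-∀

  even-or-odd : ∀ z → Even z ⊎ Odd z
  even-or-odd z with z %ℕ 2 | n%ℕd<d z 2 | a≡a%ℕn+[a/ℕn]*n z 2
  ... | 0 | _ | z≡ = inj₁ (z /ℕ 2 , trans z≡ (eq (z /ℕ 2)))
    where
    eq : ∀ q → + 0 ℤ.+ q ℤ.* + 2 ≡ + 2 ℤ.* q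
    eq = solve-∀
  ... | 1 | _ | z≡ = inj₂ (z /ℕ 2 , trans z≡ (eq (z /ℕ 2)))
    where
    eq : ∀ q → 1ℤ ℤ.+ q ℤ.* + 2 ≡ 1ℤ ℤ.+ + 2 ℤ.* q
    eq = solve-∀
  ... | suc (suc _) | s≤s (s≤s ()) | _

  odd⇒≢0 : ∀ {z} → Odd z → z ≢ 0ℤ
  odd⇒≢0 z-odd refl = even⇒¬odd (0ℤ , refl) z-odd

  odd+even : ∀ {u v} → Odd u → Even v → Odd (u ℤ.+ v)
  odd+even (s , refl) (t , refl) = s ℤ.+ t , identity s t
    where
    identity : ∀ s t → 1ℤ ℤ.+ + 2 ℤ.* s ℤ.+ + 2 ℤ.* t ≡ 1ℤ ℤ.+ + 2 ℤ.* (s ℤ.+ t)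
    identity = solve-∀

  odd-*⇒oddʳ : ∀ x y → Odd (x ℤ.* y) → Odd y
  odd-*⇒oddʳ x y xy-odd with even-or-odd y
  ... | inj₂ y-odd = y-odd
  ... | inj₁ (k , refl) = ⊥-elim (even⇒¬odd (x ℤ.* k , eq x k) xy-odd)
    where
    eq : ∀ x k → x ℤ.* (+ 2 ℤ.* k) ≡ + 2 ℤ.* (x ℤ.* k)
    eq = solve-∀

  odd-+even⇒odd : ∀ x k → Odd (x ℤ.+ + 2 ℤ.* k) → Odd x
  odd-+even⇒odd x k (l , x+2k≡1+2l) = l ℤ.- k , (begin
    x                                         ≡⟨ eq₁ x k ⟩
    x ℤ.+ + 2 ℤ.* k ℤ.- + 2 ℤ.* k             ≡⟨ cong (ℤ._- + 2 ℤ.* k) x+2k≡1+2l ⟩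
    1ℤ ℤ.+ + 2 ℤ.* l ℤ.- + 2 ℤ.* k            ≡⟨ eq₂ k l ⟩
    1ℤ ℤ.+ + 2 ℤ.* (l ℤ.- k)                  ∎)
    where
    open ≡-Reasoning
    eq₁ : ∀ x k → x ≡ x ℤ.+ + 2 ℤ.* k ℤ.- + 2 ℤ.* k
    eq₁ = solve-∀
    eq₂ : ∀ k l → 1ℤ ℤ.+ + 2 ℤ.* l ℤ.- + 2 ℤ.* k ≡ 1ℤ ℤ.+ + 2 ℤ.* (l ℤ.- k)
    eq₂ = solve-∀

  even-*ˡ : ∀ {x} y → Even x → Even (x ℤ.* y)
  even-*ˡ y (k , refl) = k ℤ.* y , ℤ.*-assoc (+ 2) k y

  even-*ʳ : ∀ x {y} → Even y → Even (x ℤ.* y)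
  even-*ʳ x {y} y-even = subst Even (ℤ.*-comm y x) (even-*ˡ x y-even)

  even-−2* : ∀ {x} r → Even x → Even (x ℤ.- + 2 ℤ.* r)
  even-−2* r (k , refl) = k ℤ.- r , eq k r
    where
    eq : ∀ k r → + 2 ℤ.* k ℤ.- + 2 ℤ.* r ≡ + 2 ℤ.* (k ℤ.- r)
    eq = solve-∀

  odd²+odd² : ∀ {s t} → Odd s → Odd t → Even (s ℤ.* s ℤ.+ t ℤ.* t)
  odd²+odd² (k , refl) (l , refl) = 1ℤ ℤ.+ + 2 ℤ.* (k ℤ.* (k ℤ.+ 1ℤ) ℤ.+ l ℤ.* (l ℤ.+ 1ℤ)) , eq k l
    where
    eq : ∀ k l → (1ℤ ℤ.+ + 2 ℤ.* k) ℤ.* (1ℤ ℤ.+ + 2 ℤ.* k) ℤ.+ (1ℤ ℤ.+ + 2 ℤ.* l) ℤ.* (1ℤ ℤ.+ + 2 ℤ.* l)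
               ≡ + 2 ℤ.* (1ℤ ℤ.+ + 2 ℤ.* (k ℤ.* (k ℤ.+ 1ℤ) ℤ.+ l ℤ.* (l ℤ.+ 1ℤ)))
    eq = solve-∀

  odd-u²-2v² : ∀ {u v} → Odd u → Even v → Odd (u ℤ.* u ℤ.- + 2 ℤ.* v ℤ.* v)
  odd-u²-2v² (s , refl) (t , refl) = + 2 ℤ.* s ℤ.+ + 2 ℤ.* s ℤ.* s ℤ.- + 4 ℤ.* t ℤ.* t , identity s t
    where
    identity : ∀ s t → (1ℤ ℤ.+ + 2 ℤ.* s) ℤ.* (1ℤ ℤ.+ + 2 ℤ.* s) ℤ.- + 2 ℤ.* (+ 2 ℤ.* t) ℤ.* (+ 2 ℤ.* t)
                     ≡ 1ℤ ℤ.+ + 2 ℤ.* (+ 2 ℤ.* s ℤ.+ + 2 ℤ.* s ℤ.* s ℤ.- + 4 ℤ.* t ℤ.* t)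
    identity = solve-∀

module NormsOfZζ8 where

  open PellEquation
  open IntegerParity
  open import Data.Nat using (z≤n)
  import Data.Nat.Properties as ℕ
  open import Data.Integer as ℤ using (ℤ; +_; -[1+_]; 1ℤ; 0ℤ; _≤_; +≤+)
  open import Data.Integer.Properties as ℤ using (pos-*; abs-*; 0≤i⇒+∣i∣≡i)
  open import Data.Integer.Tactic.RingSolver using (solve-∀)
  open import Data.Product using (_,_; ∃-syntax)
  open import Data.Sum using (inj₁; inj₂)
  open import Data.Empty using (⊥-elim)
  open import Relation.Binary.PropositionalEquality
  open import Function using (_∘_)

  -- w ↦ u + v√2 is the norm from ℚ(ζ₈) to ℚ(√2), hence multiplicative
  uOf-* : ∀ x w → uOf (x *₈ w) ≡ uOf x ℤ.* uOf w ℤ.+ + 2 ℤ.* (vOf x ℤ.* vOf w)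
  uOf-* (mk a b c d) (mk e f g h) = identity a b c d e f g h
    where
    identity : ∀ a b c d e f g h →
      let A = a ℤ.* e ℤ.- b ℤ.* h ℤ.- c ℤ.* g ℤ.- d ℤ.* f
          B = a ℤ.* f ℤ.+ b ℤ.* e ℤ.- c ℤ.* h ℤ.- d ℤ.* g
          C = a ℤ.* g ℤ.+ b ℤ.* f ℤ.+ c ℤ.* e ℤ.- d ℤ.* h
          D = a ℤ.* h ℤ.+ b ℤ.* g ℤ.+ c ℤ.* f ℤ.+ d ℤ.* e
      in A ℤ.* A ℤ.+ B ℤ.* B ℤ.+ C ℤ.* C ℤ.+ D ℤ.* D
         ≡ (a ℤ.* a ℤ.+ b ℤ.* b ℤ.+ c ℤ.* c ℤ.+ d ℤ.* d) ℤ.* (e ℤ.* e ℤ.+ f ℤ.* f ℤ.+ g ℤ.* g ℤ.+ h ℤ.* h)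
           ℤ.+ + 2 ℤ.* ((a ℤ.* b ℤ.- a ℤ.* d ℤ.+ b ℤ.* c ℤ.+ c ℤ.* d) ℤ.* (e ℤ.* f ℤ.- e ℤ.* h ℤ.+ f ℤ.* g ℤ.+ g ℤ.* h))
    identity = solve-∀

  vOf-* : ∀ x w → vOf (x *₈ w) ≡ uOf x ℤ.* vOf w ℤ.+ vOf x ℤ.* uOf w
  vOf-* (mk a b c d) (mk e f g h) = identity a b c d e f g h
    where
    identity : ∀ a b c d e f g h →
      let A = a ℤ.* e ℤ.- b ℤ.* h ℤ.- c ℤ.* g ℤ.- d ℤ.* f
          B = a ℤ.* f ℤ.+ b ℤ.* e ℤ.- c ℤ.* h ℤ.- d ℤ.* g
          C = a ℤ.* g ℤ.+ b ℤ.* f ℤ.+ c ℤ.* e ℤ.- d ℤ.* h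
          D = a ℤ.* h ℤ.+ b ℤ.* g ℤ.+ c ℤ.* f ℤ.+ d ℤ.* e
      in A ℤ.* B ℤ.- A ℤ.* D ℤ.+ B ℤ.* C ℤ.+ C ℤ.* D
         ≡ (a ℤ.* a ℤ.+ b ℤ.* b ℤ.+ c ℤ.* c ℤ.+ d ℤ.* d) ℤ.* (e ℤ.* f ℤ.- e ℤ.* h ℤ.+ f ℤ.* g ℤ.+ g ℤ.* h)
           ℤ.+ (a ℤ.* b ℤ.- a ℤ.* d ℤ.+ b ℤ.* c ℤ.+ c ℤ.* d) ℤ.* (e ℤ.* e ℤ.+ f ℤ.* f ℤ.+ g ℤ.* g ℤ.+ h ℤ.* h)
    identity = solve-∀

  norm : Zζ8 → ℤ
  norm w = uOf w ℤ.* uOf w ℤ.- + 2 ℤ.* vOf w ℤ.* vOf w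

  norm-* : ∀ x w → norm (x *₈ w) ≡ norm x ℤ.* norm w
  norm-* x w = trans (cong₂ (λ U V → U ℤ.* U ℤ.- + 2 ℤ.* V ℤ.* V) (uOf-* x w) (vOf-* x w))
                     (identity (uOf x) (vOf x) (uOf w) (vOf w))
    where
    identity : ∀ U V u v → (U ℤ.* u ℤ.+ + 2 ℤ.* (V ℤ.* v)) ℤ.* (U ℤ.* u ℤ.+ + 2 ℤ.* (V ℤ.* v))
                           ℤ.- + 2 ℤ.* (U ℤ.* v ℤ.+ V ℤ.* u) ℤ.* (U ℤ.* v ℤ.+ V ℤ.* u)
                         ≡ (U ℤ.* U ℤ.- + 2 ℤ.* V ℤ.* V) ℤ.* (u ℤ.* u ℤ.- + 2 ℤ.* v ℤ.* v)
    identity = solve-∀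

  0≤square : ∀ x → 0ℤ ≤ x ℤ.* x
  0≤square (+ n)    = subst (0ℤ ≤_) (pos-* n n) (+≤+ z≤n)
  0≤square -[1+ n ] = +≤+ z≤n

  0≤+ : ∀ {x y} → 0ℤ ≤ x → 0ℤ ≤ y → 0ℤ ≤ x ℤ.+ y
  0≤+ = ℤ.+-mono-≤

  0≤uOf : ∀ w → 0ℤ ≤ uOf w
  0≤uOf (mk a b c d) = 0≤+ (0≤+ (0≤+ (0≤square a) (0≤square b)) (0≤square c)) (0≤square d)

  -- N(w) = |(a² − c² + 2bd) + (2ac − b² + d²) i|², the inner number being the norm of w to ℚ(i)
  0≤norm : ∀ w → 0ℤ ≤ norm w
  0≤norm (mk a b c d) = subst (0ℤ ≤_) (sym (identity a b c d)) (0≤+ (0≤square X) (0≤square Y))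
    where
    X = a ℤ.* a ℤ.- c ℤ.* c ℤ.+ + 2 ℤ.* b ℤ.* d
    Y = + 2 ℤ.* a ℤ.* c ℤ.- b ℤ.* b ℤ.+ d ℤ.* d
    identity : ∀ a b c d →
      (a ℤ.* a ℤ.+ b ℤ.* b ℤ.+ c ℤ.* c ℤ.+ d ℤ.* d) ℤ.* (a ℤ.* a ℤ.+ b ℤ.* b ℤ.+ c ℤ.* c ℤ.+ d ℤ.* d)
      ℤ.- + 2 ℤ.* (a ℤ.* b ℤ.- a ℤ.* d ℤ.+ b ℤ.* c ℤ.+ c ℤ.* d) ℤ.* (a ℤ.* b ℤ.- a ℤ.* d ℤ.+ b ℤ.* c ℤ.+ c ℤ.* d)
      ≡ (a ℤ.* a ℤ.- c ℤ.* c ℤ.+ + 2 ℤ.* b ℤ.* d) ℤ.* (a ℤ.* a ℤ.- c ℤ.* c ℤ.+ + 2 ℤ.* b ℤ.* d)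
        ℤ.+ (+ 2 ℤ.* a ℤ.* c ℤ.- b ℤ.* b ℤ.+ d ℤ.* d) ℤ.* (+ 2 ℤ.* a ℤ.* c ℤ.- b ℤ.* b ℤ.+ d ℤ.* d)
    identity = solve-∀

  0≤gOf : ∀ w → 0ℤ ≤ gOf w
  0≤gOf (mk a b c d) = halve (subst (0ℤ ≤_) (identity a b c d)
    (0≤+ (0≤+ (0≤+ (0≤square (a ℤ.+ b)) (0≤square (a ℤ.- d))) (0≤square (b ℤ.+ c))) (0≤square (c ℤ.+ d))))
    where
    halve : ∀ {g} → 0ℤ ≤ + 2 ℤ.* g → 0ℤ ≤ g
    halve {+ _}      _ = +≤+ z≤n
    halve { -[1+ _ ]} ()
    identity : ∀ a b c d →
      (a ℤ.+ b) ℤ.* (a ℤ.+ b) ℤ.+ (a ℤ.- d) ℤ.* (a ℤ.- d) ℤ.+ (b ℤ.+ c) ℤ.* (b ℤ.+ c) ℤ.+ (c ℤ.+ d) ℤ.* (c ℤ.+ d)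
      ≡ + 2 ℤ.* ((a ℤ.* a ℤ.+ b ℤ.* b ℤ.+ c ℤ.* c ℤ.+ d ℤ.* d) ℤ.+ (a ℤ.* b ℤ.- a ℤ.* d ℤ.+ b ℤ.* c ℤ.+ c ℤ.* d))
    identity = solve-∀

  odd-u-mod-2 : ∀ z y → Odd (uOf (z +₈ y *₈ two8)) → Odd (uOf z)
  odd-u-mod-2 (mk a b c d) (mk e f g h) =
    odd-+even⇒odd _ (+ 2 ℤ.* (a ℤ.* e ℤ.+ b ℤ.* f ℤ.+ c ℤ.* g ℤ.+ d ℤ.* h ℤ.+ e ℤ.* e ℤ.+ f ℤ.* f ℤ.+ g ℤ.* g ℤ.+ h ℤ.* h))
      ∘ subst Odd (identity a b c d e f g h)
    where
    identity : ∀ a b c d e f g h →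
      let E = e ℤ.* + 2 ℤ.- f ℤ.* + 0 ℤ.- g ℤ.* + 0 ℤ.- h ℤ.* + 0
          F = e ℤ.* + 0 ℤ.+ f ℤ.* + 2 ℤ.- g ℤ.* + 0 ℤ.- h ℤ.* + 0
          G = e ℤ.* + 0 ℤ.+ f ℤ.* + 0 ℤ.+ g ℤ.* + 2 ℤ.- h ℤ.* + 0
          H = e ℤ.* + 0 ℤ.+ f ℤ.* + 0 ℤ.+ g ℤ.* + 0 ℤ.+ h ℤ.* + 2
      in (a ℤ.+ E) ℤ.* (a ℤ.+ E) ℤ.+ (b ℤ.+ F) ℤ.* (b ℤ.+ F) ℤ.+ (c ℤ.+ G) ℤ.* (c ℤ.+ G) ℤ.+ (d ℤ.+ H) ℤ.* (d ℤ.+ H)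
         ≡ (a ℤ.* a ℤ.+ b ℤ.* b ℤ.+ c ℤ.* c ℤ.+ d ℤ.* d)
           ℤ.+ + 2 ℤ.* (+ 2 ℤ.* (a ℤ.* e ℤ.+ b ℤ.* f ℤ.+ c ℤ.* g ℤ.+ d ℤ.* h ℤ.+ e ℤ.* e ℤ.+ f ℤ.* f ℤ.+ g ℤ.* g ℤ.+ h ℤ.* h))
    identity = solve-∀

  OddIdeal⇒odd-u : ∀ {w} → OddIdeal w → Odd (uOf w)
  OddIdeal⇒odd-u {w} (x , y , xw+2y≡1) =
    odd-*⇒oddʳ (uOf x) (uOf w) (odd-+even⇒odd _ (vOf x ℤ.* vOf w) (subst Odd (uOf-* x w) u[xw]-odd))
    where
    u[xw]-odd : Odd (uOf (x *₈ w))
    u[xw]-odd = odd-u-mod-2 (x *₈ w) y (subst (Odd ∘ uOf) (sym xw+2y≡1) (0ℤ , refl))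

  -- modulo 2, v ≡ (a + c)(b + d) and u ≡ (a + c)² + (b + d)²
  odd-u⇒even-v : ∀ w → Odd (uOf w) → Even (vOf w)
  odd-u⇒even-v (mk a b c d) u-odd = subst Even (sym (v≡ a b c d)) (even-−2* (a ℤ.* d) [a+c][b+d]-even)
    where
    v≡ : ∀ a b c d → a ℤ.* b ℤ.- a ℤ.* d ℤ.+ b ℤ.* c ℤ.+ c ℤ.* d ≡ (a ℤ.+ c) ℤ.* (b ℤ.+ d) ℤ.- + 2 ℤ.* (a ℤ.* d)
    v≡ = solve-∀
    u≡ : ∀ a b c d → a ℤ.* a ℤ.+ b ℤ.* b ℤ.+ c ℤ.* c ℤ.+ d ℤ.* d
                   ≡ (a ℤ.+ c) ℤ.* (a ℤ.+ c) ℤ.+ (b ℤ.+ d) ℤ.* (b ℤ.+ d) ℤ.- + 2 ℤ.* (a ℤ.* c ℤ.+ b ℤ.* d)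
    u≡ = solve-∀
    [a+c][b+d]-even : Even ((a ℤ.+ c) ℤ.* (b ℤ.+ d))
    [a+c][b+d]-even with even-or-odd (a ℤ.+ c) | even-or-odd (b ℤ.+ d)
    ... | inj₁ a+c-even | _              = even-*ˡ (b ℤ.+ d) a+c-even
    ... | inj₂ _        | inj₁ b+d-even  = even-*ʳ (a ℤ.+ c) b+d-even
    ... | inj₂ a+c-odd  | inj₂ b+d-odd   = ⊥-elim (even⇒¬odd u-even u-odd)
      where
      u-even : Even (uOf (mk a b c d))
      u-even = subst Even (sym (u≡ a b c d)) (even-−2* (a ℤ.* c ℤ.+ b ℤ.* d) (odd²+odd² a+c-odd b+d-odd))

  norm-unit : ∀ {w x y} → w ≡ y *₈ (x *₈ w) → norm w ≢ 0ℤ → norm x ≡ 1ℤ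
  norm-unit {w} {x} {y} w≡yxw Nw≢0 = begin
    norm x             ≡⟨ 0≤i⇒+∣i∣≡i (0≤norm x) ⟨
    + ℤ.∣ norm x ∣     ≡⟨ cong +_ (ℕ.m*n≡1⇒n≡1 ℤ.∣ norm y ∣ ℤ.∣ norm x ∣ (trans (sym (abs-* (norm y) (norm x))) (cong ℤ.∣_∣ NyNx≡1))) ⟩
    1ℤ                 ∎
    where
    open ≡-Reasoning
    NyNx≡1 : norm y ℤ.* norm x ≡ 1ℤ
    NyNx≡1 = ℤ.*-cancelˡ-≡ (norm w) _ _ {{ℤ.≢-nonZero Nw≢0}} (begin
      norm w ℤ.* (norm y ℤ.* norm x)   ≡⟨ rotate (norm w) (norm y) (norm x) ⟩
      norm y ℤ.* (norm x ℤ.* norm w)   ≡⟨ cong (norm y ℤ.*_) (norm-* x w) ⟨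
      norm y ℤ.* norm (x *₈ w)         ≡⟨ norm-* y (x *₈ w) ⟨
      norm (y *₈ (x *₈ w))             ≡⟨ cong norm w≡yxw ⟨
      norm w                           ≡⟨ ℤ.*-identityʳ (norm w) ⟨
      norm w ℤ.* 1ℤ                    ∎)
      where
      rotate : ∀ W Y X → W ℤ.* (Y ℤ.* X) ≡ Y ℤ.* (X ℤ.* W)
      rotate = solve-∀

  unit⇒PellResidue : ∀ {x} → norm x ≡ 1ℤ → PellResidue (uOf x) (vOf x)
  unit⇒PellResidue {x} Nx≡1 = subst (λ U → PellResidue U (vOf x)) +∣u∣≡u
    (pell⇒PellResidue ℤ.∣ uOf x ∣ (vOf x) (subst (λ U → Pell U (vOf x)) (sym +∣u∣≡u) Nx≡1))
    where
    +∣u∣≡u = 0≤i⇒+∣i∣≡i (0≤uOf x)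

  PellResidue-*-mod-4 : ∀ {U V u v} → PellResidue U V → Odd u → Even v →
              ∃[ z ] (U ℤ.* u ℤ.+ + 2 ℤ.* (V ℤ.* v)) ℤ.+ (U ℤ.* v ℤ.+ V ℤ.* u) ≡ (u ℤ.+ v) ℤ.+ z ℤ.* + 4
  PellResidue-*-mod-4 (k , m , refl , refl) (s , refl) (t , refl) = m ℤ.* (1ℤ ℤ.+ + 2 ℤ.* s ℤ.+ + 2 ℤ.* t) ℤ.+ k ℤ.* t , identity k m s t
    where
    identity : ∀ k m s t →
      let U = 1ℤ ℤ.+ + 4 ℤ.* m ℤ.- + 2 ℤ.* k
          V = + 2 ℤ.* k
          u = 1ℤ ℤ.+ + 2 ℤ.* s
          v = + 2 ℤ.* t
      in (U ℤ.* u ℤ.+ + 2 ℤ.* (V ℤ.* v)) ℤ.+ (U ℤ.* v ℤ.+ V ℤ.* u) ≡ (u ℤ.+ v) ℤ.+ (m ℤ.* (u ℤ.+ v) ℤ.+ k ℤ.* t) ℤ.* + 4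
    identity = solve-∀

  gOf-*-mod-4 : ∀ {x w} → PellResidue (uOf x) (vOf x) → Odd (uOf w) → Even (vOf w) → ∃[ z ] gOf (x *₈ w) ≡ gOf w ℤ.+ z ℤ.* + 4
  gOf-*-mod-4 {x} {w} x-residue u-odd v-even =
    let z , eq = PellResidue-*-mod-4 x-residue u-odd v-even in z , trans (cong₂ ℤ._+_ (uOf-* x w) (vOf-* x w)) eq

open JacobiSymbol
open LegendreSymbol
open PellEquation
open IntegerParity
open NormsOfZζ8
open import Data.Nat as ℕ using (suc; _%_; NonZero)
open import Data.Nat.DivMod using ([m+kn]%n≡m%n; m∣n⇒o%n%m≡o%m)
open import Data.Nat.Divisibility using (divides)
open import Data.Integer as ℤ using (+_; -_; -[1+_]; 1ℤ; 0ℤ; _≤_; ∣_∣)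
open import Data.Integer.Properties as ℤ using (pos-*; 0≤i⇒+∣i∣≡i)
open import Data.Integer.Tactic.RingSolver using (solve-∀)
open import Data.Product using (_,_)
open import Relation.Binary.PropositionalEquality
open import Relation.Nullary using (¬_)

%-cong-ℤ : ∀ {m n} d .{{_ : NonZero d}} k → + m ≡ + n ℤ.+ k ℤ.* + d → m % d ≡ n % d
%-cong-ℤ {m} {n} d (+ k) m≡n+kd =
  trans (cong (_% d) (ℤ.+-injective (trans m≡n+kd (cong (λ x → + n ℤ.+ x) (sym (pos-* k d))))))
        ([m+kn]%n≡m%n n k d)
%-cong-ℤ {m} {n} d -[1+ k ] m≡n-[1+k]d =
  sym (trans (cong (_% d) (ℤ.+-injective n≡m+[1+k]d)) ([m+kn]%n≡m%n m (suc k) d))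
  where
  open ≡-Reasoning
  shift : ∀ N K D → N ≡ (N ℤ.+ K ℤ.* D) ℤ.+ (- K) ℤ.* D
  shift = solve-∀
  n≡m+[1+k]d : + n ≡ + (m ℕ.+ suc k ℕ.* d)
  n≡m+[1+k]d = begin
    + n                                         ≡⟨ shift (+ n) -[1+ k ] (+ d) ⟩
    (+ n ℤ.+ -[1+ k ] ℤ.* + d) ℤ.+ + suc k ℤ.* + d ≡⟨ cong (ℤ._+ + suc k ℤ.* + d) m≡n-[1+k]d ⟨
    + m ℤ.+ + suc k ℤ.* + d                     ≡⟨ cong (λ x → + m ℤ.+ x) (pos-* (suc k) d) ⟨
    + (m ℕ.+ suc k ℕ.* d)                       ∎

jacobi-1≡χ₄ : ∀ n → n % 2 ≡ 1 → jacobi (- 1ℤ) n ≡ χ₄ n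
jacobi-1≡χ₄ = jacobi≡χ (- 1ℤ) χ₄ refl (λ {m} {n} → χ₄-* {m} {n}) legendre-1≡χ₄

jacobi-1-mod-4 : ∀ {g g′} z → 0ℤ ≤ g → 0ℤ ≤ g′ → Odd g → g′ ≡ g ℤ.+ z ℤ.* + 4 →
                 jacobi (- 1ℤ) ∣ g ∣ ≡ jacobi (- 1ℤ) ∣ g′ ∣
jacobi-1-mod-4 {g} {g′} z 0≤g 0≤g′ (k , g≡1+2k) g′≡g+4z = begin
  jacobi (- 1ℤ) ∣ g ∣    ≡⟨ jacobi-1≡χ₄ ∣ g ∣ G-odd ⟩
  χ₄ ∣ g ∣               ≡⟨ χ₄-cong ∣ g ∣ ∣ g′ ∣ (sym G′≡G) ⟩
  χ₄ ∣ g′ ∣              ≡⟨ jacobi-1≡χ₄ ∣ g′ ∣ G′-odd ⟨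
  jacobi (- 1ℤ) ∣ g′ ∣   ∎
  where
  open ≡-Reasoning
  +G≡g = 0≤i⇒+∣i∣≡i 0≤g
  +G′≡g′ = 0≤i⇒+∣i∣≡i 0≤g′
  G′≡G : ∣ g′ ∣ % 4 ≡ ∣ g ∣ % 4
  G′≡G = %-cong-ℤ 4 z (trans +G′≡g′ (trans g′≡g+4z (cong (λ x → x ℤ.+ z ℤ.* + 4) (sym +G≡g))))
  G-odd : ∣ g ∣ % 2 ≡ 1
  G-odd = %-cong-ℤ 2 k (trans +G≡g (trans g≡1+2k (swap k)))
    where
    swap : ∀ k → 1ℤ ℤ.+ + 2 ℤ.* k ≡ 1ℤ ℤ.+ k ℤ.* + 2
    swap = solve-∀
  G′-odd : ∣ g′ ∣ % 2 ≡ 1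
  G′-odd = trans (sym (m∣n⇒o%n%m≡o%m 2 4 ∣ g′ ∣ (divides 2 refl)))
             (trans (cong (_% 2) G′≡G) (trans (m∣n⇒o%n%m≡o%m 2 4 ∣ g ∣ (divides 2 refl)) G-odd))

lemma4p1 : (w w' : Zζ8) → ¬ (w ≡ zero8) → OddIdeal w → SameIdeal w w' →
    jacobi (- (+ 1)) ∣ gOf w ∣ ≡ jacobi (- (+ 1)) ∣ gOf w' ∣
lemma4p1 w _ _ w-odd ((x , refl) , (y , w≡yxw)) =
  let z , gxw≡gw+4z = gOf-*-mod-4 {x} {w} (unit⇒PellResidue {x} x-unit) u-odd v-even
  in jacobi-1-mod-4 z (0≤gOf w) (0≤gOf (x *₈ w)) (odd+even {uOf w} u-odd v-even) gxw≡gw+4z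
  where
  u-odd : Odd (uOf w)
  u-odd = OddIdeal⇒odd-u {w} w-odd
  v-even : Even (vOf w)
  v-even = odd-u⇒even-v w u-odd
  x-unit : norm x ≡ 1ℤ
  x-unit = norm-unit {w} {x} {y} w≡yxw (odd⇒≢0 (odd-u²-2v² {uOf w} u-odd v-even))
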